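{- For $0\le\ell\le n$ let $P_{n,\ell}(s,t)$ be the permanent of the $n\times n$ matrix whose first $n-\ell$ diagonal entries equal $s+t$ and all of whose other entries equal $t$. Define $Q_n(x)=\sum_{\ell=0}^{n}\binom{n}{\ell}x^{\ell}P_{n,\ell}(s,t)$. Then $$Q_n(x)=P_{n,0}(s,\,t+xt).$$
   Context: $s,t,x$ are scalars (or indeterminates); $P_{n,0}(s,t)=\operatorname{per}(sI+tJ)$ with $I$, $J$ the $n\times n$ identity and all-ones matrices. -}

module Defs where

open import Algebra.Bundles using (CommutativeRing)
open import Data.Nat using (ℕ; zero; suc; _∸_; _<ᵇ_)
open import Data.Nat.Combinatorics using (_C_)
open import Data.Fin using (Fin; zero; suc; toℕ)
open import Data.Fin.Properties using (_≟_)
open import Data.List using (List; []; _∷_; [_]; map; concatMap; foldr; allFin; upTo)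
open import Data.Bool using (Bool; true; false; if_then_else_; _∧_; _∨_; not)
open import Relation.Nullary.Decidable using (⌊_⌋)

allFuns : (n m : ℕ) → List (Fin n → Fin m)
allFuns zero    m = [ (λ ()) ]
allFuns (suc n) m =
  concatMap (λ f → map (λ k → λ { zero → k ; (suc i) → f i }) (allFin m)) (allFuns n m)

allᵇ : (n : ℕ) → (Fin n → Bool) → Bool
allᵇ n p = foldr (λ i b → p i ∧ b) true (allFin n)

-- σ is injective (hence a permutation, as Fin n is finite).
isPermᵇ : (n : ℕ) → (Fin n → Fin n) → Bool
isPermᵇ n σ = allᵇ n (λ i → allᵇ n (λ j → ⌊ i ≟ j ⌋ ∨ not ⌊ σ i ≟ σ j ⌋))

module _ {c ℓ} (R : CommutativeRing c ℓ) where
  open CommutativeRing R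

  _·_ : ℕ → Carrier → Carrier
  zero  · a = 0#
  suc n · a = a + n · a

  _^_ : Carrier → ℕ → Carrier
  a ^ zero  = 1#
  a ^ suc n = a * a ^ n

  ∏ : (n : ℕ) → (Fin n → Carrier) → Carrier
  ∏ n f = foldr (λ i r → f i * r) 1# (allFin n)

  ∑ : {A : Set} → List A → (A → Carrier) → Carrier
  ∑ xs f = foldr (λ a r → f a + r) 0# xs

  per : (n : ℕ) → (Fin n → Fin n → Carrier) → Carrier
  per n M = ∑ (allFuns n n) (λ σ → if isPermᵇ n σ then ∏ n (λ i → M i (σ i)) else 0#)

  Mat : (n k : ℕ) → Carrier → Carrier → Fin n → Fin n → Carrier
  Mat n k s t i j = if ⌊ i ≟ j ⌋ ∧ (toℕ i <ᵇ (n ∸ k)) then s + t else t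

  P : (n k : ℕ) → Carrier → Carrier → Carrier
  P n k s t = per n (Mat n k s t)

  Q : (n : ℕ) → Carrier → Carrier → Carrier → Carrier
  Q n s t x = ∑ (upTo (suc n)) (λ k → (n C k) · ((x ^ k) * P n k s t))

-- Let D be diagonal with s at its first a positions. Expanding per (t J + D), padded with r
-- extra all-t columns, by the column taken by the first row gives a recursion in n and r:
-- the first row takes one of the r + 1 columns left free by the other rows (weight t each),
-- and picks up s in addition when its own diagonal column is free; removing that column
-- leaves a matrix of the same shape with one padding column fewer. Hence P_{n,l}(s,t) is the
-- solution K of K_{n+1,r}(a+1) = (r+1) t K_{n,r+1}(a) + s K_{n,r}(a) taken at (n, 0, n - l),
-- and K_{n+1,r}(a) = (r+1) t K_{n,r+1}(a) for a ≤ n. The theorem then follows by induction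
-- on n: Pascal's rule splits the sum defining Q_{n+1} into two sums over binom(n,l), which
-- reassemble into (r+1) (t + x t) K_{n,r+1} + s K_{n,r}, the same recursion with t + x t for t.

module Submission where

open import Defs
open import Algebra.Bundles using (CommutativeRing)
open import Data.Bool using (Bool; true; false; T; if_then_else_; _∧_; _∨_; not)
open import Data.Bool.Properties using (∧-assoc; ∧-idem; ∧-commutativeMonoid; T-∧)
open import Data.Fin using (Fin; zero; suc; toℕ; punchIn; punchOut)
open import Data.Fin.Properties
  using (_≟_; toℕ<n; punchIn-injective; punchInᵢ≢i; punchIn-punchOut; punchOut-injective)
import Data.Fin.Properties as Finₚ
open import Data.List as List using (List; []; concatMap; foldr; tabulate; applyUpTo; _++_)
open import Data.Nat as ℕ using (ℕ; zero; suc; _∸_; _<ᵇ_; _<_; _≤_; s≤s)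
import Data.Nat.Properties as ℕₚ
open import Data.Nat.Combinatorics using (_C_; nCk+nC[k+1]≡[n+1]C[k+1]; k>n⇒nCk≡0)
open import Data.Product using (proj₁; proj₂)
open import Data.Vec.Functional as V using (Vector; head; tail)
open import Function using (_∘_; id)
open import Function.Bundles using (Equivalence; mk⇔)
open import Relation.Binary.PropositionalEquality as ≡ using (_≡_; _≢_; _≗_; refl; cong; cong₂)
open import Relation.Nullary.Decidable using (does; isYes≗does; dec-true; dec-false; does-⇔)
open import Algebra.Properties.CommutativeMonoid.Sum ∧-commutativeMonoid
  using () renaming (sum to every; sum-cong-≗ to every-cong; ∑-distrib-+ to every-∧)

foldr-tabulate : ∀ {a b c} {A : Set a} {B : Set b} {C : Set c}
  (_∙_ : B → C → C) (e : C) (g : A → B) {n} (h : Fin n → A) →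
  foldr (λ a r → g a ∙ r) e (tabulate h) ≡ V.foldr _∙_ e (g ∘ h)
foldr-tabulate _∙_ e g {zero}  h = refl
foldr-tabulate _∙_ e g {suc n} h = cong (g (h zero) ∙_) (foldr-tabulate _∙_ e g (h ∘ suc))

does-sym : ∀ {m} (a b : Fin m) → does (a ≟ b) ≡ does (b ≟ a)
does-sym a b = does-⇔ (mk⇔ ≡.sym ≡.sym) (a ≟ b) (b ≟ a)

does-injective : ∀ {m m′} {φ : Fin m → Fin m′} → (∀ a b → φ a ≡ φ b → a ≡ b) →
  ∀ a b → does (φ a ≟ φ b) ≡ does (a ≟ b)
does-injective φ-inj a b = does-⇔ (mk⇔ (φ-inj a b) (cong _)) (_ ≟ _) (a ≟ b)

injective? : ∀ {n m} → (Fin n → Fin m) → Bool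
injective? f = every λ i → every λ j → does (i ≟ j) ∨ not (does (f i ≟ f j))

avoids? : ∀ {n m} → Fin m → (Fin n → Fin m) → Bool
avoids? k f = every λ j → not (does (k ≟ f j))

injective?-cong : ∀ {n m} {f g : Fin n → Fin m} → f ≗ g → injective? f ≡ injective? g
injective?-cong f≗g = every-cong λ i → every-cong λ j →
  cong₂ (λ u v → does (i ≟ j) ∨ not (does (u ≟ v))) (f≗g i) (f≗g j)

avoids?-cong : ∀ {n m} (k : Fin m) {f g : Fin n → Fin m} → f ≗ g → avoids? k f ≡ avoids? k g
avoids?-cong k f≗g = every-cong λ j → cong (λ u → not (does (k ≟ u))) (f≗g j)

injective?-suc : ∀ {n m} (f : Fin (suc n) → Fin m) →
  injective? f ≡ avoids? (head f) (tail f) ∧ injective? (tail f)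
injective?-suc f = begin
  a ∧ every (λ i → not (does (f (suc i) ≟ f zero)) ∧ row i)
    ≡⟨ cong (a ∧_) (every-∧ _ row) ⟩
  a ∧ (every (λ i → not (does (f (suc i) ≟ f zero))) ∧ injective? (tail f))
    ≡⟨ cong (λ b → a ∧ (b ∧ injective? (tail f))) (every-cong λ i → cong not (does-sym (f (suc i)) (f zero))) ⟩
  a ∧ (a ∧ injective? (tail f))
    ≡⟨ ≡.sym (∧-assoc a a _) ⟩
  (a ∧ a) ∧ injective? (tail f)
    ≡⟨ cong (_∧ injective? (tail f)) (∧-idem a) ⟩
  a ∧ injective? (tail f) ∎
  where
  open ≡.≡-Reasoning
  a = avoids? (head f) (tail f)
  row : Fin _ → Bool
  row i = every λ j → does (i ≟ j) ∨ not (does (f (suc i) ≟ f (suc j)))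

allᵇ≡every : ∀ n (p : Fin n → Bool) → allᵇ n p ≡ every p
allᵇ≡every n p = foldr-tabulate _∧_ true p id

isPermᵇ≡injective? : ∀ n (σ : Fin n → Fin n) → isPermᵇ n σ ≡ injective? σ
isPermᵇ≡injective? n σ = ≡.trans (allᵇ≡every n _) (every-cong λ i →
  ≡.trans (allᵇ≡every n _) (every-cong λ j →
    cong₂ (λ u v → u ∨ not v) (isYes≗does (i ≟ j)) (isYes≗does (σ i ≟ σ j))))

module _ {c ℓ} (R : CommutativeRing c ℓ) where
  open CommutativeRing R hiding (zero)
    renaming (refl to ≈-refl; sym to ≈-sym; trans to ≈-trans)
  open import Algebra.Definitions.RawMonoid +-rawMonoid using (_×_)
  open import Algebra.Properties.Semiring.Sum semiring
    using (sum; sum-remove; sum-cong-≋; sum-cong-≗; sum-replicate; sum-replicate-zero; ∑-distrib-+; *-distribˡ-sum; *-distribʳ-sum)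
  open import Algebra.Properties.Monoid.Sum *-monoid
    using () renaming (sum to product; sum-cong-≋ to product-cong)
  open import Algebra.Properties.Group +-group using (∙-cancelˡ)
  open import Algebra.Properties.CommutativeSemigroup +-commutativeSemigroup
    using () renaming (interchange to +-interchange; x∙yz≈xz∙y to x+[y+z]≈[x+z]+y; xy∙z≈xz∙y to [x+y]+z≈[x+z]+y)
  open import Algebra.Properties.CommutativeSemigroup *-commutativeSemigroup
    using () renaming (interchange to *-interchange; x∙yz≈y∙xz to x*[y*z]≈y*[x*z])
  open import Algebra.Properties.Semiring.Mult semiring using (×-congˡ; ×-congʳ; ×-homo-+; ×-comm-*)
  open import Algebra.Properties.CommutativeMonoid.Mult +-commutativeMonoid using (×-distrib-+)
  open import Relation.Binary.Reasoning.Setoid setoid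

  ∑-cong : ∀ {A : Set} (xs : List A) {f g : A → Carrier} → (∀ a → f a ≈ g a) → ∑ R xs f ≈ ∑ R xs g
  ∑-cong []           f≈g = ≈-refl
  ∑-cong (a List.∷ xs) f≈g = +-cong (f≈g a) (∑-cong xs f≈g)

  ∑-++ : ∀ {A : Set} (xs ys : List A) f → ∑ R (xs ++ ys) f ≈ ∑ R xs f + ∑ R ys f
  ∑-++ []            ys f = ≈-sym (+-identityˡ _)
  ∑-++ (a List.∷ xs) ys f = ≈-trans (+-congˡ (∑-++ xs ys f)) (≈-sym (+-assoc _ _ _))

  ∑-concatMap : ∀ {A B : Set} (g : A → List B) (xs : List A) f →
    ∑ R (concatMap g xs) f ≈ ∑ R xs (λ a → ∑ R (g a) f)
  ∑-concatMap g []            f = ≈-refl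
  ∑-concatMap g (a List.∷ xs) f = ≈-trans (∑-++ (g a) _ f) (+-congˡ (∑-concatMap g xs f))

  ∑-map : ∀ {A B : Set} (φ : A → B) (xs : List A) f → ∑ R (List.map φ xs) f ≡ ∑ R xs (f ∘ φ)
  ∑-map φ []            f = refl
  ∑-map φ (a List.∷ xs) f = cong (f (φ a) +_) (∑-map φ xs f)

  ∑-linear : ∀ {A : Set} (xs : List A) a b f g →
    ∑ R xs (λ z → a * f z + b * g z) ≈ a * ∑ R xs f + b * ∑ R xs g
  ∑-linear []            a b f g = ≈-sym (≈-trans (+-cong (zeroʳ a) (zeroʳ b)) (+-identityʳ 0#))
  ∑-linear (z List.∷ xs) a b f g = begin
    (a * f z + b * g z) + ∑ R xs (λ z → a * f z + b * g z)
      ≈⟨ +-congˡ (∑-linear xs a b f g) ⟩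
    (a * f z + b * g z) + (a * ∑ R xs f + b * ∑ R xs g)
      ≈⟨ +-interchange _ _ _ _ ⟩
    (a * f z + a * ∑ R xs f) + (b * g z + b * ∑ R xs g)
      ≈⟨ +-cong (≈-sym (distribˡ a _ _)) (≈-sym (distribˡ b _ _)) ⟩
    a * (f z + ∑ R xs f) + b * (g z + ∑ R xs g) ∎

  ∑-allFin : ∀ m (g : Fin m → Carrier) → ∑ R (List.allFin m) g ≡ sum g
  ∑-allFin m g = foldr-tabulate _+_ 0# g id

  when : Bool → Carrier → Carrier
  when b x = if b then x else 0#

  when-cong : ∀ {b b′ x y} → b ≡ b′ → x ≈ y → when b x ≈ when b′ y
  when-cong {true}  refl x≈y = x≈y
  when-cong {false} refl x≈y = ≈-refl

  when-congᵀ : ∀ b {x y} → (T b → x ≈ y) → when b x ≈ when b y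
  when-congᵀ true  x≈y = x≈y _
  when-congᵀ false x≈y = ≈-refl

  when-true : ∀ {b x} → T b → when b x ≡ x
  when-true {true} _ = refl

  when-∧ : ∀ b b′ x → when (b ∧ b′) x ≡ when b (when b′ x)
  when-∧ true  b′ x = refl
  when-∧ false b′ x = refl

  when-comm : ∀ b b′ x → when b (when b′ x) ≡ when b′ (when b x)
  when-comm true  b′    x = refl
  when-comm false true  x = refl
  when-comm false false x = refl

  when-+ : ∀ b x y → when b (x + y) ≈ when b x + when b y
  when-+ true  x y = ≈-refl
  when-+ false x y = ≈-sym (+-identityʳ 0#)

  when-*ˡ : ∀ b x y → when b (x * y) ≈ x * when b y
  when-*ˡ true  x y = ≈-refl
  when-*ˡ false x y = ≈-sym (zeroʳ x)

  when-*ʳ : ∀ b x y → when b (x * y) ≈ when b x * y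
  when-*ʳ true  x y = ≈-refl
  when-*ʳ false x y = ≈-sym (zeroˡ y)

  sum-when : ∀ {m} b (g : Vector Carrier m) → sum (λ j → when b (g j)) ≈ when b (sum g)
  sum-when     true  g = ≈-refl
  sum-when {m} false g = sum-replicate-zero m

  sum-δ : ∀ {m} (p : Fin (suc m)) (g : Vector Carrier (suc m)) →
    sum (λ k → when (does (p ≟ k)) (g k)) ≈ g p
  sum-δ {m} p g = begin
    sum (λ k → when (does (p ≟ k)) (g k))
      ≈⟨ sum-remove {i = p} (λ k → when (does (p ≟ k)) (g k)) ⟩
    when (does (p ≟ p)) (g p) + sum (λ j → when (does (p ≟ punchIn p j)) (g (punchIn p j)))
      ≈⟨ +-cong (when-cong (dec-true (p ≟ p) refl) ≈-refl)
                (sum-cong-≋ λ j → when-cong (dec-false (p ≟ punchIn p j) (punchInᵢ≢i p j ∘ ≡.sym)) ≈-refl) ⟩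
    g p + sum {m} (λ _ → 0#)
      ≈⟨ +-congˡ (sum-replicate-zero m) ⟩
    g p + 0#
      ≈⟨ +-identityʳ (g p) ⟩
    g p ∎

  sum-skip : ∀ {m} (p : Fin (suc m)) (g : Vector Carrier (suc m)) →
    sum (λ k → when (not (does (p ≟ k))) (g k)) ≈ sum (λ j → g (punchIn p j))
  sum-skip {m} p g = begin
    sum (λ k → when (not (does (p ≟ k))) (g k))
      ≈⟨ sum-remove {i = p} (λ k → when (not (does (p ≟ k))) (g k)) ⟩
    when (not (does (p ≟ p))) (g p) + sum (λ j → when (not (does (p ≟ punchIn p j))) (g (punchIn p j)))
      ≈⟨ +-cong (when-cong (cong not (dec-true (p ≟ p) refl)) ≈-refl)
                (sum-cong-≋ λ j → when-cong (cong not (dec-false (p ≟ punchIn p j) (punchInᵢ≢i p j ∘ ≡.sym))) ≈-refl) ⟩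
    0# + sum (λ j → g (punchIn p j))
      ≈⟨ +-identityˡ _ ⟩
    sum (λ j → g (punchIn p j)) ∎

  -- Sums over injections

  _Respects≗ : ∀ {n m} → ((Fin n → Fin m) → Carrier) → Set ℓ
  X Respects≗ = ∀ {f g} → f ≗ g → X f ≈ X g

  ∑-allFuns-suc : ∀ n m (h : (Fin (suc n) → Fin m) → Carrier) → h Respects≗ →
    ∑ R (allFuns (suc n) m) h ≈ ∑ R (allFuns n m) (λ f → sum (λ k → h (k V.∷ f)))
  ∑-allFuns-suc n m h h-resp = ≈-trans (∑-concatMap _ (allFuns n m) h) (∑-cong (allFuns n m) λ f →
    ≈-trans (reflexive (≡.trans (∑-map _ (List.allFin m) h) (∑-allFin m _)))
            (sum-cong-≋ {y = λ k → h (k V.∷ f)} λ k → h-resp λ { zero → refl ; (suc i) → refl }))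

  ∑inj : ∀ n m → ((Fin n → Fin m) → Carrier) → Carrier
  ∑inj n m X = ∑ R (allFuns n m) (λ f → when (injective? f) (X f))

  ∑inj-cong : ∀ n m {X Y : (Fin n → Fin m) → Carrier} →
    (∀ f → T (injective? f) → X f ≈ Y f) → ∑inj n m X ≈ ∑inj n m Y
  ∑inj-cong n m X≈Y = ∑-cong (allFuns n m) λ f → when-congᵀ (injective? f) (X≈Y f)

  ∑inj-linear : ∀ n m a b (X Y : (Fin n → Fin m) → Carrier) →
    ∑inj n m (λ f → a * X f + b * Y f) ≈ a * ∑inj n m X + b * ∑inj n m Y
  ∑inj-linear n m a b X Y = ≈-trans
    (∑-cong (allFuns n m) λ f → ≈-trans (when-+ (injective? f) _ _)
      (+-cong (when-*ˡ (injective? f) a (X f)) (when-*ˡ (injective? f) b (Y f))))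
    (∑-linear (allFuns n m) a b _ _)

  ∑inj-suc : ∀ n m (X : (Fin (suc n) → Fin m) → Carrier) → X Respects≗ →
    ∑inj (suc n) m X ≈ ∑inj n m (λ f → sum (λ k → when (avoids? k f) (X (k V.∷ f))))
  ∑inj-suc n m X X-resp = ≈-trans
    (∑-allFuns-suc n m _ λ f≗g → when-cong (injective?-cong f≗g) (X-resp f≗g))
    (∑-cong (allFuns n m) λ f → ≈-trans
      (sum-cong-≋ {y = λ k → when (injective? f) (when (avoids? k f) (X (k V.∷ f)))} λ k →
        reflexive (≡.trans (cong (λ b → when b (X (k V.∷ f))) (injective?-suc (k V.∷ f)))
          (≡.trans (when-∧ (avoids? k f) (injective? f) _) (when-comm (avoids? k f) (injective? f) _))))
      (sum-when (injective? f) (λ k → when (avoids? k f) (X (k V.∷ f)))))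

  ∑-avoids : ∀ {n m} r (f : Fin n → Fin m) → T (injective? f) → m ≡ n ℕ.+ r → ∀ a →
    sum (λ k → when (avoids? k f) a) ≈ r × a
  ∑-avoids {zero}          r f _   refl a = sum-replicate r
  ∑-avoids {suc n} {zero}  r f _   ()
  -- tail f avoids exactly one column more than f, namely head f; cancel it.
  ∑-avoids {suc n} {suc m} r f inj eq a = begin
    sum (λ k → when (avoids? k f) a)
      ≈⟨ sum-remove {i = p} (λ k → when (avoids? k f) a) ⟩
    when (avoids? p f) a + sum (λ j → when (avoids? (punchIn p j) f) a)
      ≈⟨ +-cong (reflexive (cong (λ b → when (not b ∧ avoids? p f′) a) (dec-true (p ≟ p) refl)))
                (sum-cong-≋ λ j → reflexive (cong (λ b → when (not b ∧ avoids? (punchIn p j) f′) a)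
                                                  (dec-false (punchIn p j ≟ p) (punchInᵢ≢i p j)))) ⟩
    0# + Z
      ≈⟨ +-identityˡ Z ⟩
    Z
      ≈⟨ ∙-cancelˡ a Z (r × a) (begin
           a + Z                               ≈⟨ +-cong (≈-sym (reflexive (when-true p-avoided))) ≈-refl ⟩
           when (avoids? p f′) a + Z           ≈⟨ sum-remove {i = p} (λ k → when (avoids? k f′) a) ⟨
           sum (λ k → when (avoids? k f′) a)   ≈⟨ ∑-avoids (suc r) f′ f′-injective eq′ a ⟩
           a + r × a                           ∎) ⟩
    r × a ∎
    where
    p = head f
    f′ = tail f
    Z = sum (λ j → when (avoids? (punchIn p j) f′) a)
    eq′ : suc m ≡ n ℕ.+ suc r
    eq′ = ≡.trans eq (≡.sym (ℕₚ.+-suc n r))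
    split-injective = Equivalence.to T-∧ (≡.subst T (injective?-suc f) inj)
    p-avoided = proj₁ split-injective
    f′-injective = proj₂ split-injective

  ∑inj-avoiding : ∀ n m (p : Fin (suc m)) (X : (Fin n → Fin (suc m)) → Carrier) → X Respects≗ →
    ∑inj n (suc m) (λ f → when (avoids? p f) (X f)) ≈ ∑inj n m (λ g → X (punchIn p ∘ g))
  ∑inj-avoiding zero    m p X X-resp = +-congʳ (X-resp λ ())
  ∑inj-avoiding (suc n) m p X X-resp = begin
    ∑inj (suc n) (suc m) (λ f → when (avoids? p f) (X f))
      ≈⟨ ∑inj-suc n (suc m) _ (λ f≗g → when-cong (avoids?-cong p f≗g) (X-resp f≗g)) ⟩
    ∑inj n (suc m) (λ f → sum (λ k → when (avoids? k f) (when (not (does (p ≟ k)) ∧ avoids? p f) (X (k V.∷ f)))))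
      ≈⟨ ∑-cong (allFuns n (suc m)) (λ f → when-cong {injective? f} refl (remove-p f)) ⟩
    ∑inj n (suc m) (λ f → when (avoids? p f) (X′ f))
      ≈⟨ ∑inj-avoiding n m p X′ X′-resp ⟩
    ∑inj n m (λ g → X′ (punchIn p ∘ g))
      ≈⟨ ∑-cong (allFuns n m) (λ g → when-cong {injective? g} refl (sum-cong-≋ λ j →
           when-cong (every-cong λ i → cong not (does-injective (punchIn-injective p) j (g i)))
                     (X-resp λ { zero → refl ; (suc i) → refl }))) ⟩
    ∑inj n m (λ g → sum (λ j → when (avoids? j g) (X (punchIn p ∘ (j V.∷ g)))))
      ≈⟨ ∑inj-suc n m (λ g → X (punchIn p ∘ g)) (λ f≗g → X-resp (cong (punchIn p) ∘ f≗g)) ⟨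
    ∑inj (suc n) m (λ g → X (punchIn p ∘ g)) ∎
    where
    X′ : (Fin n → Fin (suc m)) → Carrier
    X′ f = sum (λ j → when (avoids? (punchIn p j) f) (X (punchIn p j V.∷ f)))
    X′-resp : X′ Respects≗
    X′-resp f≗g = sum-cong-≋ λ j → when-cong (avoids?-cong (punchIn p j) f≗g)
                                             (X-resp λ { zero → refl ; (suc i) → f≗g i })
    remove-p : ∀ f → sum (λ k → when (avoids? k f) (when (not (does (p ≟ k)) ∧ avoids? p f) (X (k V.∷ f))))
                     ≈ when (avoids? p f) (X′ f)
    remove-p f = begin
      sum (λ k → when (avoids? k f) (when (not (does (p ≟ k)) ∧ avoids? p f) (X (k V.∷ f))))
        ≡⟨ sum-cong-≗ (λ k → ≡.trans (cong (when (avoids? k f)) (when-∧ (not (does (p ≟ k))) (avoids? p f) (X (k V.∷ f))))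
                            (≡.trans (when-comm (avoids? k f) (not (does (p ≟ k))) _)
                                     (cong (when (not (does (p ≟ k)))) (when-comm (avoids? k f) (avoids? p f) _)))) ⟩
      sum (λ k → when (not (does (p ≟ k))) (when (avoids? p f) (when (avoids? k f) (X (k V.∷ f)))))
        ≈⟨ sum-skip p (λ k → when (avoids? p f) (when (avoids? k f) (X (k V.∷ f)))) ⟩
      sum (λ j → when (avoids? p f) (when (avoids? (punchIn p j) f) (X (punchIn p j V.∷ f))))
        ≈⟨ sum-when (avoids? p f) (λ j → when (avoids? (punchIn p j) f) (X (punchIn p j V.∷ f))) ⟩
      when (avoids? p f) (X′ f) ∎

  -- Permanents of t J + D

  rper : ∀ {n m} → (Fin n → Fin m → Carrier) → Carrier
  rper {n} {m} M = ∑inj n m (λ f → product (λ i → M i (f i)))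

  rper-term-resp : ∀ {n m} (M : Fin n → Fin m → Carrier) → (λ f → product (λ i → M i (f i))) Respects≗
  rper-term-resp M f≗g = product-cong λ i → reflexive (cong (M i) (f≗g i))

  rper-cong : ∀ {n m} {M N : Fin n → Fin m → Carrier} → (∀ i j → M i j ≈ N i j) → rper M ≈ rper N
  rper-cong {n} {m} M≈N = ∑inj-cong n m λ f _ → product-cong λ i → M≈N i (f i)

  per≈rper : ∀ n M → per R n M ≈ rper M
  per≈rper n M = ∑-cong (allFuns n n) λ σ →
    reflexive (cong₂ when (isPermᵇ≡injective? n σ) (foldr-tabulate _*_ 1# (λ i → M i (σ i)) id))

  tJ+D : ∀ {n m} → Carrier → (Fin n → Fin m) → Vector Carrier n → Fin n → Fin m → Carrier
  tJ+D t c d i j = t + when (does (c i ≟ j)) (d i)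

  -- The permanent of t J + diag d padded with r columns of t's (rper-tJ+D).
  padPer : Carrier → ∀ {n} → ℕ → Vector Carrier n → Carrier
  padPer t {zero}  r d = 1#
  padPer t {suc n} r d = (suc r × t) * padPer t (suc r) (tail d) + head d * padPer t r (tail d)

  ∑-avoids-row : ∀ {n m} r (f : Fin n → Fin (suc m)) → T (injective? f) → suc m ≡ n ℕ.+ r →
    ∀ p t d₀ w → sum (λ k → when (avoids? k f) ((t + when (does (p ≟ k)) d₀) * w))
                   ≈ (r × t) * w + d₀ * when (avoids? p f) w
  ∑-avoids-row r f f-inj eq p t d₀ w = begin
    sum (λ k → when (avoids? k f) ((t + δ k) * w))
      ≈⟨ sum-cong-≋ (λ k → ≈-trans (when-*ʳ (avoids? k f) _ w) (*-congʳ (when-+ (avoids? k f) t (δ k)))) ⟩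
    sum (λ k → (when (avoids? k f) t + when (avoids? k f) (δ k)) * w)
      ≈⟨ *-distribʳ-sum w (λ k → when (avoids? k f) t + when (avoids? k f) (δ k)) ⟨
    sum (λ k → when (avoids? k f) t + when (avoids? k f) (δ k)) * w
      ≈⟨ *-congʳ (∑-distrib-+ (λ k → when (avoids? k f) t) (λ k → when (avoids? k f) (δ k))) ⟩
    (sum (λ k → when (avoids? k f) t) + sum (λ k → when (avoids? k f) (δ k))) * w
      ≈⟨ *-congʳ (+-cong (∑-avoids r f f-inj eq t)
                         (≈-trans (sum-cong-≋ λ k → reflexive (when-comm (avoids? k f) (does (p ≟ k)) d₀))
                                  (sum-δ p (λ k → when (avoids? k f) d₀)))) ⟩
    (r × t + when (avoids? p f) d₀) * w
      ≈⟨ distribʳ w (r × t) _ ⟩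
    (r × t) * w + when (avoids? p f) d₀ * w
      ≈⟨ +-congˡ (≈-trans (≈-sym (when-*ʳ (avoids? p f) d₀ w)) (when-*ˡ (avoids? p f) d₀ w)) ⟩
    (r × t) * w + d₀ * when (avoids? p f) w ∎
    where
    δ : Fin _ → Carrier
    δ k = when (does (p ≟ k)) d₀

  rper-tJ+D : ∀ {n m} r t (c : Fin n → Fin m) d → (∀ a b → c a ≡ c b → a ≡ b) → m ≡ n ℕ.+ r →
    rper (tJ+D t c d) ≈ padPer t r d
  rper-tJ+D {zero}          r t c d _     _  = +-identityʳ 1#
  rper-tJ+D {suc n} {zero}  r t c d _     ()
  rper-tJ+D {suc n} {suc m} r t c d c-inj eq = begin
    rper (tJ+D t c d)
      ≈⟨ ∑inj-suc n (suc m) _ (rper-term-resp (tJ+D t c d)) ⟩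
    ∑inj n (suc m) (λ f → sum (λ k → when (avoids? k f) ((t + when (does (p ≟ k)) (head d)) * W f)))
      ≈⟨ ∑inj-cong n (suc m) (λ f f-inj → ∑-avoids-row (suc r) f f-inj eq′ p t (head d) (W f)) ⟩
    ∑inj n (suc m) (λ f → (suc r × t) * W f + head d * when (avoids? p f) (W f))
      ≈⟨ ∑inj-linear n (suc m) (suc r × t) (head d) W _ ⟩
    (suc r × t) * rper (tJ+D t (tail c) (tail d)) + head d * ∑inj n (suc m) (λ f → when (avoids? p f) (W f))
      ≈⟨ +-cong (*-congˡ (rper-tJ+D (suc r) t (tail c) (tail d) (λ a b → Finₚ.suc-injective ∘ c-inj (suc a) (suc b)) eq′))
                (*-congˡ (∑inj-avoiding n m p W (rper-term-resp W-entry))) ⟩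
    (suc r × t) * padPer t (suc r) (tail d) + head d * ∑inj n m (λ g → W (punchIn p ∘ g))
      ≈⟨ +-congˡ (*-congˡ (≈-trans (rper-cong {M = λ i j → W-entry i (punchIn p j)} W-punchIn)
                                   (rper-tJ+D r t c′ (tail d) c′-inj (ℕₚ.suc-injective eq)))) ⟩
    padPer t r d ∎
    where
    p = head c
    W-entry = tJ+D t (tail c) (tail d)
    W : (Fin n → Fin (suc m)) → Carrier
    W f = product (λ i → W-entry i (f i))
    eq′ : suc m ≡ n ℕ.+ suc r
    eq′ = ≡.trans eq (≡.sym (ℕₚ.+-suc n r))
    p≢ : ∀ i → p ≢ c (suc i)
    p≢ i e with () ← c-inj zero (suc i) e
    c′ : Fin n → Fin m
    c′ i = punchOut (p≢ i)
    c′-inj : ∀ a b → c′ a ≡ c′ b → a ≡ b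
    c′-inj a b = Finₚ.suc-injective ∘ c-inj (suc a) (suc b) ∘ punchOut-injective (p≢ a) (p≢ b)
    W-punchIn : ∀ i j → W-entry i (punchIn p j) ≈ tJ+D t c′ (tail d) i j
    W-punchIn i j = +-congˡ (reflexive (cong (λ b → when b (d (suc i)))
      (≡.trans (cong (λ k → does (k ≟ punchIn p j)) (≡.sym (punchIn-punchOut (p≢ i))))
               (does-injective (punchIn-injective p) (c′ i) j))))

  -- The binomial identity

  prefix : ∀ {n} → Carrier → ℕ → Vector Carrier n
  prefix s a i = when (toℕ i <ᵇ a) s

  P≈padPer : ∀ n k s t → P R n k s t ≈ padPer t {n} 0 (prefix s (n ∸ k))
  P≈padPer n k s t = begin
    P R n k s t
      ≈⟨ per≈rper n (Mat R n k s t) ⟩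
    rper (Mat R n k s t)
      ≈⟨ rper-cong {n} {n} (λ i j → ≈-trans (reflexive (cong (λ b → if b ∧ _ then s + t else t) (isYes≗does (i ≟ j))))
                                    (if∧ (does (i ≟ j)) _)) ⟩
    rper {n} {n} (tJ+D t id (prefix s (n ∸ k)))
      ≈⟨ rper-tJ+D 0 t id _ (λ _ _ → id) (≡.sym (ℕₚ.+-identityʳ n)) ⟩
    padPer t {n} 0 (prefix s (n ∸ k)) ∎
    where
    if∧ : ∀ b b′ → (if b ∧ b′ then s + t else t) ≈ t + when b (when b′ s)
    if∧ true  true  = +-comm s t
    if∧ true  false = ≈-sym (+-identityʳ t)
    if∧ false b′    = ≈-sym (+-identityʳ t)

  ∑< : ℕ → (ℕ → Carrier) → Carrier
  ∑< n g = sum {n} (g ∘ toℕ)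

  ∑-applyUpTo : ∀ {A : Set} (f : ℕ → A) n g → ∑ R (applyUpTo f n) g ≡ ∑< n (g ∘ f)
  ∑-applyUpTo f zero    g = refl
  ∑-applyUpTo f (suc n) g = cong (g (f 0) +_) (∑-applyUpTo (f ∘ suc) n g)

  ∑<-cong : ∀ n {g h : ℕ → Carrier} → (∀ l → l < n → g l ≈ h l) → ∑< n g ≈ ∑< n h
  ∑<-cong n g≈h = sum-cong-≋ λ i → g≈h (toℕ i) (toℕ<n i)

  ∑<-+ : ∀ n f g → ∑< n (λ l → f l + g l) ≈ ∑< n f + ∑< n g
  ∑<-+ n f g = ∑-distrib-+ {n} (f ∘ toℕ) (g ∘ toℕ)

  ∑<-*ˡ : ∀ n a g → ∑< n (λ l → a * g l) ≈ a * ∑< n g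
  ∑<-*ˡ n a g = ≈-sym (*-distribˡ-sum {n} a (g ∘ toℕ))

  ∑<-snoc : ∀ n g → ∑< (suc n) g ≈ ∑< n g + g n
  ∑<-snoc zero    g = +-comm (g 0) 0#
  ∑<-snoc (suc n) g = ≈-trans (+-congˡ (∑<-snoc n (g ∘ suc))) (≈-sym (+-assoc _ _ _))

  ∑<-pascal : ∀ n (g : ℕ → Carrier) → ∑< (suc (suc n)) (λ l → (suc n C l) × g l)
    ≈ ∑< (suc n) (λ l → (n C l) × g l) + ∑< (suc n) (λ l → (n C l) × g (suc l))
  ∑<-pascal n g = begin
    g₀ + ∑< (suc n) (λ l → (suc n C suc l) × g (suc l))
      ≈⟨ +-congˡ (∑<-cong (suc n) λ l _ → ≈-trans (×-congˡ (≡.sym (nCk+nC[k+1]≡[n+1]C[k+1] n l)))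
                                                   (×-homo-+ (g (suc l)) (n C l) (n C suc l))) ⟩
    g₀ + ∑< (suc n) (λ l → (n C l) × g (suc l) + (n C suc l) × g (suc l))
      ≈⟨ +-congˡ (∑<-+ (suc n) (λ l → (n C l) × g (suc l)) (λ l → (n C suc l) × g (suc l))) ⟩
    g₀ + (B + ∑< (suc n) (λ l → (n C suc l) × g (suc l)))
      ≈⟨ +-congˡ (+-congˡ (∑<-snoc n (λ l → (n C suc l) × g (suc l)))) ⟩
    g₀ + (B + (C′ + (n C suc n) × g (suc n)))
      ≈⟨ +-congˡ (+-congˡ (+-congˡ (×-congˡ (k>n⇒nCk≡0 (ℕₚ.n<1+n n))))) ⟩
    g₀ + (B + (C′ + 0#))
      ≈⟨ +-congˡ (+-congˡ (+-identityʳ C′)) ⟩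
    g₀ + (B + C′)
      ≈⟨ x+[y+z]≈[x+z]+y g₀ B C′ ⟩
    (g₀ + C′) + B ∎
    where
    g₀ = 1 × g 0
    B = ∑< (suc n) (λ l → (n C l) × g (suc l))
    C′ = ∑< n (λ l → (n C suc l) × g (suc l))

  module _ (s x : Carrier) where

    padPer-short-prefix : ∀ t n r a → a ≤ n →
      padPer t {suc n} r (prefix s a) ≈ (suc r × t) * padPer t {n} (suc r) (prefix s a)
    padPer-short-prefix t n       r zero    _         = ≈-trans (+-congˡ (zeroˡ _)) (+-identityʳ _)
    padPer-short-prefix t (suc n) r (suc a) (s≤s a≤n) = begin
      X * padPer t {suc n} (suc r) (prefix s a) + s * padPer t {suc n} r (prefix s a)
        ≈⟨ +-cong (*-congˡ (padPer-short-prefix t n (suc r) a a≤n)) (*-congˡ (padPer-short-prefix t n r a a≤n)) ⟩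
      X * (X′ * Q₁) + s * (X * Q₂)
        ≈⟨ +-congˡ (x*[y*z]≈y*[x*z] s X Q₂) ⟩
      X * (X′ * Q₁) + X * (s * Q₂)
        ≈⟨ distribˡ X _ _ ⟨
      X * (X′ * Q₁ + s * Q₂) ∎
      where
      X = suc r × t
      X′ = suc (suc r) × t
      Q₁ = padPer t {n} (suc (suc r)) (prefix s a)
      Q₂ = padPer t {n} (suc r) (prefix s a)

    binomial-padPer : ∀ t n r →
      ∑< (suc n) (λ l → (n C l) × (_^_ R x l * padPer t {n} r (prefix s (n ∸ l))))
        ≈ padPer (t + x * t) {n} r (prefix s n)
    binomial-padPer t zero    r = ≈-trans (+-identityʳ _) (≈-trans (+-identityʳ _) (*-identityˡ 1#))
    binomial-padPer t (suc n) r = begin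
      ∑< (suc (suc n)) (λ l → (suc n C l) × g l)
        ≈⟨ ∑<-pascal n g ⟩
      ∑< (suc n) (λ l → (n C l) × g l) + ∑< (suc n) (λ l → (n C l) × g (suc l))
        ≈⟨ +-cong (∑<-cong (suc n) λ l l<1+n → diagonal l (ℕₚ.≤-pred l<1+n))
                  (∑<-cong (suc n) λ l _ → off-diagonal l) ⟩
      ∑< (suc n) (λ l → X * ℓ₁ l + s * ℓ₂ l) + ∑< (suc n) (λ l → (x * X) * ℓ₁ l)
        ≈⟨ +-cong (≈-trans (∑<-+ (suc n) (λ l → X * ℓ₁ l) (λ l → s * ℓ₂ l)) (+-cong (∑<-*ˡ (suc n) X ℓ₁) (∑<-*ˡ (suc n) s ℓ₂)))
                  (∑<-*ˡ (suc n) (x * X) ℓ₁) ⟩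
      (X * ∑< (suc n) ℓ₁ + s * ∑< (suc n) ℓ₂) + (x * X) * ∑< (suc n) ℓ₁
        ≈⟨ [x+y]+z≈[x+z]+y _ _ _ ⟩
      (X * ∑< (suc n) ℓ₁ + (x * X) * ∑< (suc n) ℓ₁) + s * ∑< (suc n) ℓ₂
        ≈⟨ +-congʳ (distribʳ _ X (x * X)) ⟨
      (X + x * X) * ∑< (suc n) ℓ₁ + s * ∑< (suc n) ℓ₂
        ≈⟨ +-cong (*-cong X-shift (binomial-padPer t n (suc r))) (*-congˡ (binomial-padPer t n r)) ⟩
      padPer (t + x * t) {suc n} r (prefix s (suc n)) ∎
      where
      X = suc r × t
      g : ℕ → Carrier
      g l = _^_ R x l * padPer t {suc n} r (prefix s (suc n ∸ l))
      ℓ₁ ℓ₂ : ℕ → Carrier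
      ℓ₁ l = (n C l) × (_^_ R x l * padPer t {n} (suc r) (prefix s (n ∸ l)))
      ℓ₂ l = (n C l) × (_^_ R x l * padPer t {n} r (prefix s (n ∸ l)))
      X-shift : X + x * X ≈ suc r × (t + x * t)
      X-shift = ≈-sym (≈-trans (×-distrib-+ t (x * t) (suc r)) (+-congˡ (≈-sym (×-comm-* (suc r) x t))))
      diagonal : ∀ l → l ≤ n → (n C l) × g l ≈ X * ℓ₁ l + s * ℓ₂ l
      diagonal l l≤n = begin
        (n C l) × (xˡ * padPer t {suc n} r (prefix s (suc n ∸ l)))
          ≡⟨ cong (λ a → (n C l) × (xˡ * padPer t {suc n} r (prefix s a))) (ℕₚ.+-∸-assoc 1 l≤n) ⟩
        (n C l) × (xˡ * (X * Q₁ + s * Q₂))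
          ≈⟨ ×-congʳ (n C l) (≈-trans (distribˡ xˡ _ _) (+-cong (x*[y*z]≈y*[x*z] xˡ X Q₁) (x*[y*z]≈y*[x*z] xˡ s Q₂))) ⟩
        (n C l) × (X * (xˡ * Q₁) + s * (xˡ * Q₂))
          ≈⟨ ×-distrib-+ _ _ (n C l) ⟩
        (n C l) × (X * (xˡ * Q₁)) + (n C l) × (s * (xˡ * Q₂))
          ≈⟨ +-cong (×-comm-* (n C l) X _) (×-comm-* (n C l) s _) ⟨
        X * ℓ₁ l + s * ℓ₂ l ∎
        where
        xˡ = _^_ R x l
        Q₁ = padPer t {n} (suc r) (prefix s (n ∸ l))
        Q₂ = padPer t {n} r (prefix s (n ∸ l))
      off-diagonal : ∀ l → (n C l) × g (suc l) ≈ (x * X) * ℓ₁ l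
      off-diagonal l = begin
        (n C l) × ((x * _^_ R x l) * padPer t {suc n} r (prefix s (n ∸ l)))
          ≈⟨ ×-congʳ (n C l) (*-congˡ (padPer-short-prefix t n r (n ∸ l) (ℕₚ.m∸n≤m n l))) ⟩
        (n C l) × ((x * _^_ R x l) * (X * padPer t {n} (suc r) (prefix s (n ∸ l))))
          ≈⟨ ×-congʳ (n C l) (*-interchange x _ X _) ⟩
        (n C l) × ((x * X) * (_^_ R x l * padPer t {n} (suc r) (prefix s (n ∸ l))))
          ≈⟨ ×-comm-* (n C l) (x * X) _ ⟨
        (x * X) * ℓ₁ l ∎

  ·≡× : ∀ n a → _·_ R n a ≡ n × a
  ·≡× zero    a = refl
  ·≡× (suc n) a = cong (a +_) (·≡× n a)

  Q≈∑< : ∀ n s t x → Q R n s t x ≈ ∑< (suc n) (λ l → (n C l) × (_^_ R x l * padPer t {n} 0 (prefix s (n ∸ l))))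
  Q≈∑< n s t x = ≈-trans (reflexive (∑-applyUpTo id (suc n) (λ l → _·_ R (n C l) (_^_ R x l * P R n l s t))))
    (∑<-cong (suc n) λ l _ → ≈-trans (reflexive (·≡× (n C l) (_^_ R x l * P R n l s t)))
                                     (×-congʳ (n C l) (*-congˡ (P≈padPer n l s t))))

proposition5p6 : ∀ {c ℓ} (R : CommutativeRing c ℓ) (n : ℕ) (s t x : CommutativeRing.Carrier R) →
    CommutativeRing._≈_ R (Q R n s t x)
      (P R n 0 s (CommutativeRing._+_ R t (CommutativeRing._*_ R x t)))
proposition5p6 R n s t x = begin
  Q R n s t x
    ≈⟨ Q≈∑< R n s t x ⟩
  ∑< R (suc n) (λ l → (n C l) × (_^_ R x l * padPer R t {n} 0 (prefix R s (n ∸ l))))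
    ≈⟨ binomial-padPer R s x t n 0 ⟩
  padPer R (t + x * t) {n} 0 (prefix R s n)
    ≈⟨ P≈padPer R n 0 s (t + x * t) ⟨
  P R n 0 s (t + x * t) ∎
  where
  open CommutativeRing R
  open import Algebra.Definitions.RawMonoid +-rawMonoid using (_×_)
  open import Relation.Binary.Reasoning.Setoid setoid
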